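{- Let $n \geq 2$ and $m \geq 2$ be integers. Then $\mathbb{Z}_m^n$ is $H$-closed if and only if the basic Ducci sequence of $\mathbb{Z}_m^n$, i.e. the Ducci sequence of $(0,0,\dots,0,1) \in \mathbb{Z}_m^n$, is $H$-closed.
   Context: The Ducci function is the endomorphism $D$ of $\mathbb{Z}_m^n$ given by $D(x_1,\dots,x_n)=(x_1+x_2 \bmod m, x_2+x_3 \bmod m,\dots,x_n+x_1 \bmod m)$, and $H$ is the endomorphism $H(x_1,\dots,x_n)=(x_2,x_3,\dots,x_n,x_1)$; $H^{\beta}$ for negative $\beta$ denotes the inverse power. The Ducci sequence of $\mathbf{u}$ is $\{D^{\alpha}(\mathbf{u})\}_{\alpha \geq 0}$. The Ducci cycle of $\mathbf{u}$ is the set of $\mathbf{v}$ for which there exist integers $\alpha \geq 0$, $\beta \geq 1$ with $\mathbf{v}=D^{\alpha+\beta}(\mathbf{u})=D^{\alpha}(\mathbf{u})$. The Ducci sequence of $\mathbf{u}$ is called $H$-closed if for every $\mathbf{v}$ in the Ducci cycle of $\mathbf{u}$ and every $-n<\beta<n$, $H^{\beta}(\mathbf{v})$ also belongs to the Ducci cycle of $\mathbf{u}$; $\mathbb{Z}_m^n$ is called $H$-closed if the Ducci sequence of every $\mathbf{u} \in \mathbb{Z}_m^n$ is $H$-closed. -}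

module Defs where

open import Data.Nat using (ℕ; zero; suc; _+_; _∸_; _<_; NonZero; s≤s; z≤n)
open import Data.Nat.DivMod using (_%_)
open import Data.Integer as ℤ using (ℤ; +_; -[1+_])
open import Data.Fin using (Fin; toℕ; fromℕ<)
open import Data.Nat.Properties using (<-trans)
open import Data.Nat.DivMod using (m%n<n)
open import Data.Vec using (Vec; lookup; tabulate; replicate; _∷ʳ_)
open import Data.Product using (∃; ∃-syntax; _×_)
open import Relation.Binary.PropositionalEquality using (_≡_)
open import Function using (_∘_)

_+ₘ_ : ∀ {m} .{{_ : NonZero m}} → Fin m → Fin m → Fin m
_+ₘ_ {m} a b = fromℕ< (m%n<n (toℕ a + toℕ b) m)

shiftIdx : ∀ {n} .{{_ : NonZero n}} → ℕ → Fin n → Fin n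
shiftIdx {n} k i = fromℕ< (m%n<n (toℕ i + k) n)

D : ∀ {m n} .{{_ : NonZero m}} .{{_ : NonZero n}} → Vec (Fin m) n → Vec (Fin m) n
D x = tabulate λ i → lookup x i +ₘ lookup x (shiftIdx 1 i)

H : ∀ {m n} .{{_ : NonZero n}} → Vec (Fin m) n → Vec (Fin m) n
H x = tabulate λ i → lookup x (shiftIdx 1 i)

Hinv : ∀ {m n} .{{_ : NonZero n}} → Vec (Fin m) n → Vec (Fin m) n
Hinv {n = n} x = tabulate λ i → lookup x (shiftIdx (n ∸ 1) i)

iter : ∀ {A : Set} → ℕ → (A → A) → A → A
iter zero    f a = a
iter (suc k) f a = f (iter k f a)

Hpow : ∀ {m n} .{{_ : NonZero n}} → ℤ → Vec (Fin m) n → Vec (Fin m) n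
Hpow (+ k)      = iter k H
Hpow -[1+ k ]   = iter (suc k) Hinv

InDucciCycle : ∀ {m n} .{{_ : NonZero m}} .{{_ : NonZero n}} →
  Vec (Fin m) n → Vec (Fin m) n → Set
InDucciCycle u v =
  ∃[ α ] ∃[ β ] (v ≡ iter (α + suc β) D u × v ≡ iter α D u)

HClosedSeq : ∀ {m n} .{{_ : NonZero m}} .{{_ : NonZero n}} → Vec (Fin m) n → Set
HClosedSeq {n = n} u = ∀ v → InDucciCycle u v →
  ∀ (β : ℤ) → ℤ.- (+ n) ℤ.< β → β ℤ.< + n → InDucciCycle u (Hpow β v)

HClosed : ∀ m n .{{_ : NonZero m}} .{{_ : NonZero n}} → Set
HClosed m n = ∀ (u : Vec (Fin m) n) → HClosedSeq u

-- the basic vector (0,...,0,1)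
basic : ∀ {m n} → 1 < m → Vec (Fin m) (suc n)
basic {n = n} p = replicate n (fromℕ< (<-trans (s≤s z≤n) p)) ∷ʳ fromℕ< p

module Submission where

-- Every u ∈ ℤ_m^n is a sum g e of cyclic shifts Hᵏ e of the basic vector e, and such a g is
-- additive, so it commutes with both D and H.  Since ℤ_m^n is finite, e's Ducci sequence is
-- eventually periodic, which lets every v in the Ducci cycle of u = g e be written g y with y in
-- the Ducci cycle of e.  Closure of e's cycle under H is thus carried over to u's cycle by g, and
-- closure under H suffices because H⁻¹ = Hⁿ⁻¹.

open import Defs
open import Data.Nat using (ℕ; zero; suc; _+_; _*_; _∸_; _^_; _<_; _≤_; _≤?_; _≟_; s≤s; z≤n; NonZero)
open import Data.Nat.Properties
open import Data.Nat.DivMod using (_%_; m%n<n; %-distribˡ-+; m%n%n≡m%n; m<n⇒m%n≡m; m≤n⇒m%n≡m; [m+n]%n≡m%n)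
open import Data.Nat.ListAction using (sum)
open import Data.Nat.ListAction.Properties using (sum-++)
open import Algebra.Properties.CommutativeSemigroup +-commutativeSemigroup
  using () renaming (interchange to +-interchange)
open import Algebra.Properties.Monoid.Sum +-0-monoid using (sum-syntax; sum-cong-≗; sum-replicate-zero)
open import Data.Bool using (if_then_else_)
open import Data.Empty using (⊥-elim)
open import Data.Fin as F using (Fin; toℕ; combine)
import Data.Fin.Properties as FP
open import Data.Integer as ℤ using (+_; -[1+_])
open import Data.List as List using (List; []; _∷_; _++_; concat)
open import Data.List.Properties using (map-++)
open import Data.Product using (∃-syntax; _×_; _,_)
open import Data.Vec using (Vec; []; _∷_; lookup; tabulate)
open import Data.Vec.Properties using (lookup∘tabulate; tabulate∘lookup; tabulate-cong)
open import Function.Base using (_∘_)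
open import Function.Bundles using (_⇔_; mk⇔)
open import Relation.Binary.PropositionalEquality
open import Relation.Nullary using (yes; no)
open import Relation.Nullary.Decidable using (does; does-⇔)

private variable A : Set

Commute : (A → A) → (A → A) → Set
Commute f g = ∀ x → f (g x) ≡ g (f x)

iter-+ : ∀ (f : A → A) p q x → iter (p + q) f x ≡ iter p f (iter q f x)
iter-+ f zero    q x = refl
iter-+ f (suc p) q x = cong f (iter-+ f p q x)

iter-* : ∀ (f : A → A) p q x → iter (p * q) f x ≡ iter p (iter q f) x
iter-* f zero    q x = refl
iter-* f (suc p) q x = trans (iter-+ f q (p * q) x) (cong (iter q f) (iter-* f p q x))

iter-commute : ∀ {f g : A → A} → Commute f g → ∀ k → Commute (iter k f) g
iter-commute         f∘g zero    x = refl
iter-commute {f = f} f∘g (suc k) x = trans (cong f (iter-commute f∘g k x)) (f∘g _)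

iter-commute-iter : ∀ (f : A → A) p q → Commute (iter p f) (iter q f)
iter-commute-iter f p q = iter-commute (λ x → sym (iter-commute {f = f} {g = f} (λ _ → refl) q x)) p

iter-fixed : ∀ {f : A → A} {x} → f x ≡ x → ∀ k → iter k f x ≡ x
iter-fixed         fx≡x zero    = refl
iter-fixed {f = f} fx≡x (suc k) = trans (cong f (iter-fixed fx≡x k)) fx≡x

InCycle : (A → A) → A → A → Set
InCycle f x y = ∃[ α ] ∃[ β ] (y ≡ iter (α + suc β) f x × y ≡ iter α f x)

EventuallyPeriodic : (A → A) → A → Set
EventuallyPeriodic f x = ∃[ p ] ∃[ q ] iter (suc q) f (iter p f x) ≡ iter p f x

CycleClosedUnder : (A → A) → (A → A) → A → Set
CycleClosedUnder f h x = ∀ y → InCycle f x y → InCycle f x (h y)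

cycle-periodic : ∀ {f : A → A} {x y} α β → y ≡ iter (α + suc β) f x → y ≡ iter α f x → iter (suc β) f y ≡ y
cycle-periodic {f = f} {x} {y} α β y≡late y≡ = begin
  iter (suc β) f y             ≡⟨ cong (iter (suc β) f) y≡ ⟩
  iter (suc β) f (iter α f x)  ≡⟨ iter-commute-iter f α (suc β) x ⟨
  iter α f (iter (suc β) f x)  ≡⟨ iter-+ f α (suc β) x ⟨
  iter (α + suc β) f x         ≡⟨ y≡late ⟨
  y                            ∎
  where open ≡-Reasoning

inCycle-intro : ∀ {f : A → A} {x} α β → iter (suc β) f (iter α f x) ≡ iter α f x → InCycle f x (iter α f x)
inCycle-intro {f = f} {x} α β periodic = α , β , sym (begin
  iter (α + suc β) f x         ≡⟨ iter-+ f α (suc β) x ⟩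
  iter α f (iter (suc β) f x)  ≡⟨ iter-commute-iter f α (suc β) x ⟩
  iter (suc β) f (iter α f x)  ≡⟨ periodic ⟩
  iter α f x                   ∎) , refl
  where open ≡-Reasoning

inCycle-map : ∀ {f g : A → A} {x y} → Commute f g → InCycle f x y → InCycle f (g x) (g y)
inCycle-map {g = g} {x} f∘g (α , β , y≡late , y≡) =
  α , β , trans (cong g y≡late) (sym (iter-commute f∘g (α + suc β) x)) ,
          trans (cong g y≡) (sym (iter-commute f∘g α x))

-- The witness is taken p·(β+1) steps further than v's own index α, so that it lies
-- past the preperiod p of x while g still sends it to v.
inCycle-lift : ∀ {f g : A → A} {x v} → Commute f g → EventuallyPeriodic f x →
  InCycle f (g x) v → ∃[ y ] InCycle f x y × g y ≡ v
inCycle-lift {f = f} {g} {x} {v} f∘g (p , q , x-periodic) (α , β , v≡late , v≡) =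
  iter α′ f x , inCycle-intro α′ q y-periodic , gy≡v
  where
  open ≡-Reasoning
  α′ t : ℕ
  α′ = p * suc β + α
  t  = p * β + α

  α′≡t+p : α′ ≡ t + p
  α′≡t+p = trans (cong (_+ α) (*-suc p β)) (trans (+-assoc p (p * β) α) (+-comm p t))

  y-periodic : iter (suc q) f (iter α′ f x) ≡ iter α′ f x
  y-periodic = begin
    iter (suc q) f (iter α′ f x)          ≡⟨ cong (λ k → iter (suc q) f (iter k f x)) α′≡t+p ⟩
    iter (suc q) f (iter (t + p) f x)     ≡⟨ cong (iter (suc q) f) (iter-+ f t p x) ⟩
    iter (suc q) f (iter t f (iter p f x)) ≡⟨ iter-commute-iter f t (suc q) _ ⟨
    iter t f (iter (suc q) f (iter p f x)) ≡⟨ cong (iter t f) x-periodic ⟩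
    iter t f (iter p f x)                 ≡⟨ iter-+ f t p x ⟨
    iter (t + p) f x                      ≡⟨ cong (λ k → iter k f x) α′≡t+p ⟨
    iter α′ f x                           ∎

  gy≡v : g (iter α′ f x) ≡ v
  gy≡v = begin
    g (iter α′ f x)                      ≡⟨ iter-commute f∘g α′ x ⟨
    iter α′ f (g x)                      ≡⟨ iter-+ f (p * suc β) α (g x) ⟩
    iter (p * suc β) f (iter α f (g x))  ≡⟨ cong (iter (p * suc β) f) v≡ ⟨
    iter (p * suc β) f v                 ≡⟨ iter-* f p (suc β) v ⟩
    iter p (iter (suc β) f) v            ≡⟨ iter-fixed (cycle-periodic α β v≡late v≡) p ⟩
    v                                    ∎

cycleClosedUnder-map : ∀ {f g h : A → A} {x} → Commute f g → Commute h g → EventuallyPeriodic f x →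
  CycleClosedUnder f h x → CycleClosedUnder f h (g x)
cycleClosedUnder-map {f = f} {g} {h} {x} f∘g h∘g x-periodic closed v v∈
  with y , y∈ , gy≡v ← inCycle-lift f∘g x-periodic v∈ =
  subst (InCycle f (g x)) (trans (sym (h∘g y)) (cong h gy≡v)) (inCycle-map f∘g (closed y y∈))

cycleClosedUnder-iter : ∀ {f h : A → A} {x} → CycleClosedUnder f h x → ∀ k → CycleClosedUnder f (iter k h) x
cycleClosedUnder-iter closed zero    y y∈ = y∈
cycleClosedUnder-iter closed (suc k) y y∈ = closed _ (cycleClosedUnder-iter closed k y y∈)

encode : ∀ {m k} → Vec (Fin m) k → Fin (m ^ k)
encode []       = F.zero
encode (x ∷ xs) = combine x (encode xs)

encode-injective : ∀ {m k} (xs ys : Vec (Fin m) k) → encode xs ≡ encode ys → xs ≡ ys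
encode-injective [] [] _ = refl
encode-injective (x ∷ xs) (y ∷ ys) eq with x≡y , rest≡ ← FP.combine-injective x (encode xs) y (encode ys) eq =
  cong₂ _∷_ x≡y (encode-injective xs ys rest≡)

eventuallyPeriodic-finite : ∀ {m k} (f : Vec (Fin m) k → Vec (Fin m) k) x → EventuallyPeriodic f x
eventuallyPeriodic-finite {m} {k} f x
  with i , j , i<j , same ← FP.pigeonhole (n<1+n (m ^ k)) (λ t → encode (iter (toℕ t) f x)) =
  p , q , (begin
    iter (suc q) f (iter p f x)  ≡⟨ iter-+ f (suc q) p x ⟨
    iter (suc q + p) f x         ≡⟨ cong (λ s → iter s f x) (trans (sym (+-suc q p)) (m∸n+n≡m i<j)) ⟩
    iter (toℕ j) f x             ≡⟨ encode-injective _ _ same ⟨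
    iter p f x                   ∎)
  where
  open ≡-Reasoning
  p q : ℕ
  p = toℕ i
  q = toℕ j ∸ suc p

[m%d+n]%d≡[m+n]%d : ∀ m n d .{{_ : NonZero d}} → (m % d + n) % d ≡ (m + n) % d
[m%d+n]%d≡[m+n]%d m n d = begin
  (m % d + n) % d            ≡⟨ %-distribˡ-+ (m % d) n d ⟩
  (m % d % d + n % d) % d    ≡⟨ cong (λ r → (r + n % d) % d) (m%n%n≡m%n m d) ⟩
  (m % d + n % d) % d        ≡⟨ %-distribˡ-+ m n d ⟨
  (m + n) % d                ∎
  where open ≡-Reasoning

[m+n%d]%d≡[m+n]%d : ∀ m n d .{{_ : NonZero d}} → (m + n % d) % d ≡ (m + n) % d
[m+n%d]%d≡[m+n]%d m n d = begin
  (m + n % d) % d  ≡⟨ cong (_% d) (+-comm m (n % d)) ⟩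
  (n % d + m) % d  ≡⟨ [m%d+n]%d≡[m+n]%d n m d ⟩
  (n + m) % d      ≡⟨ cong (_% d) (+-comm n m) ⟩
  (m + n) % d      ∎
  where open ≡-Reasoning

module _ {m : ℕ} .{{_ : NonZero m}} where

  toℕ-+ₘ : ∀ (x y : Fin m) → toℕ (x +ₘ y) ≡ (toℕ x + toℕ y) % m
  toℕ-+ₘ x y = FP.toℕ-fromℕ< _

  +ₘ-interchange : ∀ (w x y z : Fin m) → (w +ₘ x) +ₘ (y +ₘ z) ≡ (w +ₘ y) +ₘ (x +ₘ z)
  +ₘ-interchange w x y z = FP.toℕ-injective (begin
    toℕ ((w +ₘ x) +ₘ (y +ₘ z))               ≡⟨ toℕ-+ₘ-+ₘ w x y z ⟩
    (toℕ w + toℕ x + (toℕ y + toℕ z)) % m    ≡⟨ cong (_% m) (+-interchange (toℕ w) (toℕ x) (toℕ y) (toℕ z)) ⟩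
    (toℕ w + toℕ y + (toℕ x + toℕ z)) % m    ≡⟨ toℕ-+ₘ-+ₘ w y x z ⟨
    toℕ ((w +ₘ y) +ₘ (x +ₘ z))               ∎)
    where
    open ≡-Reasoning
    toℕ-+ₘ-+ₘ : ∀ w x y z → toℕ ((w +ₘ x) +ₘ (y +ₘ z)) ≡ (toℕ w + toℕ x + (toℕ y + toℕ z)) % m
    toℕ-+ₘ-+ₘ w x y z = trans (toℕ-+ₘ (w +ₘ x) (y +ₘ z))
      (trans (cong₂ (λ r s → (r + s) % m) (toℕ-+ₘ w x) (toℕ-+ₘ y z))
             (sym (%-distribˡ-+ (toℕ w + toℕ x) (toℕ y + toℕ z) m)))

module _ {c n : ℕ} .{{_ : NonZero n}} where

  infixl 6 _⊕_

  _⊕_ : Vec (Fin (suc c)) n → Vec (Fin (suc c)) n → Vec (Fin (suc c)) n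
  x ⊕ y = tabulate λ i → lookup x i +ₘ lookup y i

  𝟎 : Vec (Fin (suc c)) n
  𝟎 = tabulate λ _ → F.zero

  lookup-⊕ : ∀ x y i → lookup (x ⊕ y) i ≡ lookup x i +ₘ lookup y i
  lookup-⊕ x y = lookup∘tabulate _

  lookup-𝟎 : ∀ i → lookup 𝟎 i ≡ F.zero
  lookup-𝟎 = lookup∘tabulate _

  lookup-D : ∀ (x : Vec (Fin (suc c)) n) i → lookup (D x) i ≡ lookup x i +ₘ lookup x (shiftIdx 1 i)
  lookup-D x = lookup∘tabulate _

  lookup-H : ∀ (x : Vec (Fin (suc c)) n) i → lookup (H x) i ≡ lookup x (shiftIdx 1 i)
  lookup-H x = lookup∘tabulate _

  lookup-iter-H : ∀ k (x : Vec (Fin (suc c)) n) i → lookup (iter k H x) i ≡ lookup x (shiftIdx k i)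
  lookup-iter-H zero    x i = cong (lookup x) (sym (FP.toℕ-injective shiftIdx-zero))
    where
    shiftIdx-zero : toℕ (shiftIdx 0 i) ≡ toℕ i
    shiftIdx-zero = trans (FP.toℕ-fromℕ< _) (trans (cong (_% n) (+-identityʳ (toℕ i))) (m<n⇒m%n≡m (FP.toℕ<n i)))
  lookup-iter-H (suc k) x i = begin
    lookup (H (iter k H x)) i              ≡⟨ lookup-H (iter k H x) i ⟩
    lookup (iter k H x) (shiftIdx 1 i)     ≡⟨ lookup-iter-H k x (shiftIdx 1 i) ⟩
    lookup x (shiftIdx k (shiftIdx 1 i))   ≡⟨ cong (lookup x) (FP.toℕ-injective shiftIdx-suc) ⟩
    lookup x (shiftIdx (suc k) i)          ∎
    where
    open ≡-Reasoning
    shiftIdx-suc : toℕ (shiftIdx k (shiftIdx 1 i)) ≡ toℕ (shiftIdx (suc k) i)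
    shiftIdx-suc = begin
      toℕ (shiftIdx k (shiftIdx 1 i))  ≡⟨ FP.toℕ-fromℕ< _ ⟩
      (toℕ (shiftIdx 1 i) + k) % n     ≡⟨ cong (λ r → (r + k) % n) (FP.toℕ-fromℕ< _) ⟩
      ((toℕ i + 1) % n + k) % n        ≡⟨ [m%d+n]%d≡[m+n]%d (toℕ i + 1) k n ⟩
      (toℕ i + 1 + k) % n              ≡⟨ cong (_% n) (+-assoc (toℕ i) 1 k) ⟩
      (toℕ i + suc k) % n              ≡⟨ FP.toℕ-fromℕ< _ ⟨
      toℕ (shiftIdx (suc k) i)         ∎

  Hinv≡iter-H : ∀ (x : Vec (Fin (suc c)) n) → Hinv x ≡ iter (n ∸ 1) H x
  Hinv≡iter-H x = trans (tabulate-cong λ i → sym (lookup-iter-H (n ∸ 1) x i)) (tabulate∘lookup _)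

  H-D-commute : Commute H (D {suc c} {n})
  H-D-commute x = tabulate-cong λ i →
    trans (lookup-D x (shiftIdx 1 i)) (sym (cong₂ _+ₘ_ (lookup-H x i) (lookup-H x (shiftIdx 1 i))))

  D-⊕ : ∀ x y → D (x ⊕ y) ≡ D x ⊕ D y
  D-⊕ x y = tabulate-cong λ i → begin
    lookup (x ⊕ y) i +ₘ lookup (x ⊕ y) (shiftIdx 1 i)
      ≡⟨ cong₂ _+ₘ_ (lookup-⊕ x y i) (lookup-⊕ x y (shiftIdx 1 i)) ⟩
    (lookup x i +ₘ lookup y i) +ₘ (lookup x (shiftIdx 1 i) +ₘ lookup y (shiftIdx 1 i))
      ≡⟨ +ₘ-interchange (lookup x i) (lookup y i) (lookup x (shiftIdx 1 i)) (lookup y (shiftIdx 1 i)) ⟩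
    (lookup x i +ₘ lookup x (shiftIdx 1 i)) +ₘ (lookup y i +ₘ lookup y (shiftIdx 1 i))
      ≡⟨ cong₂ _+ₘ_ (lookup-D x i) (lookup-D y i) ⟨
    lookup (D x) i +ₘ lookup (D y) i
      ∎
    where open ≡-Reasoning

  H-⊕ : ∀ x y → H (x ⊕ y) ≡ H x ⊕ H y
  H-⊕ x y = tabulate-cong λ i →
    trans (lookup-⊕ x y (shiftIdx 1 i)) (sym (cong₂ _+ₘ_ (lookup-H x i) (lookup-H y i)))

  D-𝟎 : D 𝟎 ≡ 𝟎
  D-𝟎 = tabulate-cong λ i → cong₂ _+ₘ_ (lookup-𝟎 i) (lookup-𝟎 (shiftIdx 1 i))

  H-𝟎 : H 𝟎 ≡ 𝟎
  H-𝟎 = tabulate-cong λ i → lookup-𝟎 (shiftIdx 1 i)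

  shiftSum : List ℕ → Vec (Fin (suc c)) n → Vec (Fin (suc c)) n
  shiftSum []       x = 𝟎
  shiftSum (k ∷ ks) x = iter k H x ⊕ shiftSum ks x

  shiftSum-commute : ∀ {φ} → (∀ x y → φ (x ⊕ y) ≡ φ x ⊕ φ y) → φ 𝟎 ≡ 𝟎 → Commute H φ →
    ∀ ks → Commute φ (shiftSum ks)
  shiftSum-commute φ-⊕ φ-𝟎 H∘φ []       x = φ-𝟎
  shiftSum-commute φ-⊕ φ-𝟎 H∘φ (k ∷ ks) x =
    trans (φ-⊕ _ _) (cong₂ _⊕_ (sym (iter-commute H∘φ k x)) (shiftSum-commute φ-⊕ φ-𝟎 H∘φ ks x))

  toℕ-lookup-shiftSum : ∀ ks x i →
    toℕ (lookup (shiftSum ks x) i) ≡ sum (List.map (λ k → toℕ (lookup (iter k H x) i)) ks) % suc c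
  toℕ-lookup-shiftSum []       x i = cong toℕ (lookup-𝟎 i)
  toℕ-lookup-shiftSum (k ∷ ks) x i = begin
    toℕ (lookup (iter k H x ⊕ shiftSum ks x) i)  ≡⟨ cong toℕ (lookup-⊕ (iter k H x) (shiftSum ks x) i) ⟩
    toℕ (y +ₘ z)                                 ≡⟨ toℕ-+ₘ y z ⟩
    (toℕ y + toℕ z) % suc c                      ≡⟨ cong (λ r → (toℕ y + r) % suc c) (toℕ-lookup-shiftSum ks x i) ⟩
    (toℕ y + rest % suc c) % suc c               ≡⟨ [m+n%d]%d≡[m+n]%d (toℕ y) rest (suc c) ⟩
    (toℕ y + rest) % suc c                       ∎
    where
    open ≡-Reasoning
    y = lookup (iter k H x) i
    z = lookup (shiftSum ks x) i
    rest = sum (List.map (λ k → toℕ (lookup (iter k H x) i)) ks)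

  cycleClosedUnder-H⇒hClosedSeq : ∀ {u : Vec (Fin (suc c)) n} → CycleClosedUnder D H u → HClosedSeq u
  cycleClosedUnder-H⇒hClosedSeq closed v v∈ (+ k)    _ _ = cycleClosedUnder-iter closed k v v∈
  cycleClosedUnder-H⇒hClosedSeq {u} closed v v∈ -[1+ k ] _ _ = cycleClosedUnder-iter closedHinv (suc k) v v∈
    where
    closedHinv : CycleClosedUnder D Hinv u
    closedHinv y y∈ = subst (InCycle D u) (sym (Hinv≡iter-H y)) (cycleClosedUnder-iter closed (n ∸ 1) y y∈)

indicator : ℕ → ℕ → ℕ
indicator x y = if does (x ≟ y) then 1 else 0

indicator-cong : ∀ {x y x′ y′} → x ≡ y ⇔ x′ ≡ y′ → indicator x y ≡ indicator x′ y′
indicator-cong {x} {y} {x′} {y′} eq = cong (λ b → if b then 1 else 0) (does-⇔ eq (x ≟ y) (x′ ≟ y′))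

∑-indicator : ∀ {N} (g : Fin N → ℕ) i → ∑[ j < N ] (g j * indicator (toℕ i) (toℕ j)) ≡ g i
∑-indicator {suc N} g F.zero =
  trans (cong₂ _+_ (*-identityʳ (g F.zero)) (trans (sum-cong-≗ λ j → *-zeroʳ (g (F.suc j))) (sum-replicate-zero N)))
        (+-identityʳ (g F.zero))
∑-indicator {suc N} g (F.suc i) =
  trans (cong (_+ ∑[ j < N ] (g (F.suc j) * indicator (toℕ i) (toℕ j))) (*-zeroʳ (g F.zero)))
        (∑-indicator (g ∘ F.suc) i)

sum-map-replicate : ∀ (φ : ℕ → ℕ) t k → sum (List.map φ (List.replicate t k)) ≡ t * φ k
sum-map-replicate φ zero    k = refl
sum-map-replicate φ (suc t) k = cong (_+_ (φ k)) (sum-map-replicate φ t k)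

sum-map-concat-replicate : ∀ {N} (φ : ℕ → ℕ) (g κ : Fin N → ℕ) →
  sum (List.map φ (concat (List.tabulate λ j → List.replicate (g j) (κ j)))) ≡ ∑[ j < N ] (g j * φ (κ j))
sum-map-concat-replicate {zero}  φ g κ = refl
sum-map-concat-replicate {suc N} φ g κ = begin
  sum (List.map φ (here ++ rest))                  ≡⟨ cong sum (map-++ φ here rest) ⟩
  sum (List.map φ here ++ List.map φ rest)          ≡⟨ sum-++ (List.map φ here) (List.map φ rest) ⟩
  sum (List.map φ here) + sum (List.map φ rest)     ≡⟨ cong₂ _+_ (sum-map-replicate φ (g F.zero) (κ F.zero))
                                                                 (sum-map-concat-replicate φ (g ∘ F.suc) (κ ∘ F.suc)) ⟩
  g F.zero * φ (κ F.zero) + ∑[ j < N ] (g (F.suc j) * φ (κ (F.suc j))) ∎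
  where
  open ≡-Reasoning
  here = List.replicate (g F.zero) (κ F.zero)
  rest = concat (List.tabulate λ j → List.replicate (g (F.suc j)) (κ (F.suc j)))

m+[n∸o]%[1+n]≡n⇔m≡o : ∀ {m n o} → m ≤ n → o ≤ n → (m + (n ∸ o)) % suc n ≡ n ⇔ m ≡ o
m+[n∸o]%[1+n]≡n⇔m≡o {m} {n} {o} m≤n o≤n = mk⇔ to from
  where
  open ≡-Reasoning
  from : m ≡ o → (m + (n ∸ o)) % suc n ≡ n
  from refl = trans (cong (_% suc n) (m+[n∸m]≡n o≤n)) (m≤n⇒m%n≡m ≤-refl)

  to : (m + (n ∸ o)) % suc n ≡ n → m ≡ o
  to hit with m ≤? o
  ... | yes m≤o = +-cancelʳ-≡ (n ∸ o) m o (begin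
    m + (n ∸ o)              ≡⟨ m≤n⇒m%n≡m (≤-trans (+-monoˡ-≤ (n ∸ o) m≤o) (≤-reflexive (m+[n∸m]≡n o≤n))) ⟨
    (m + (n ∸ o)) % suc n    ≡⟨ hit ⟩
    n                        ≡⟨ m+[n∸m]≡n o≤n ⟨
    o + (n ∸ o)              ∎)
  ... | no m≰o = ⊥-elim (<-irrefl (trans (sym wrapped) hit) d<n)
    where
    o<m = ≰⇒> m≰o
    d   = m ∸ suc o
    d<n : d < n
    d<n = <-≤-trans (∸-monoʳ-< (s≤s z≤n) o<m) m≤n
    wrapped : (m + (n ∸ o)) % suc n ≡ d
    wrapped = begin
      (m + (n ∸ o)) % suc n            ≡⟨ cong (λ r → (r + (n ∸ o)) % suc n) (m∸n+n≡m o<m) ⟨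
      (d + suc o + (n ∸ o)) % suc n    ≡⟨ cong (_% suc n) (+-assoc d (suc o) (n ∸ o)) ⟩
      (d + suc (o + (n ∸ o))) % suc n  ≡⟨ cong (λ r → (d + suc r) % suc n) (m+[n∸m]≡n o≤n) ⟩
      (d + suc n) % suc n              ≡⟨ [m+n]%n≡m%n d (suc n) ⟩
      d % suc n                        ≡⟨ m≤n⇒m%n≡m (<⇒≤ d<n) ⟩
      d                                ∎

toℕ-lookup-basic : ∀ {c b} (1<m : 1 < suc c) t → toℕ (lookup (basic {suc c} {b} 1<m) t) ≡ indicator (toℕ t) b
toℕ-lookup-basic {b = zero}  1<m F.zero    = FP.toℕ-fromℕ< 1<m
toℕ-lookup-basic {b = suc b} 1<m F.zero    = refl
toℕ-lookup-basic {b = suc b} 1<m (F.suc t) = toℕ-lookup-basic 1<m t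

module _ {c b : ℕ} (1<m : 1 < suc c) where

  private
    e : Vec (Fin (suc c)) (suc b)
    e = basic 1<m

  toℕ-lookup-shifted-basic : ∀ (i j : Fin (suc b)) →
    toℕ (lookup (iter (b ∸ toℕ j) H e) i) ≡ indicator (toℕ i) (toℕ j)
  toℕ-lookup-shifted-basic i j = begin
    toℕ (lookup (iter (b ∸ toℕ j) H e) i)
      ≡⟨ cong toℕ (lookup-iter-H (b ∸ toℕ j) e i) ⟩
    toℕ (lookup e (shiftIdx (b ∸ toℕ j) i))
      ≡⟨ toℕ-lookup-basic 1<m (shiftIdx (b ∸ toℕ j) i) ⟩
    indicator (toℕ (shiftIdx (b ∸ toℕ j) i)) b
      ≡⟨ cong (λ r → indicator r b) (FP.toℕ-fromℕ< (m%n<n (toℕ i + (b ∸ toℕ j)) (suc b))) ⟩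
    indicator ((toℕ i + (b ∸ toℕ j)) % suc b) b
      ≡⟨ indicator-cong (m+[n∸o]%[1+n]≡n⇔m≡o (FP.toℕ≤pred[n] i) (FP.toℕ≤pred[n] j)) ⟩
    indicator (toℕ i) (toℕ j)
      ∎
    where open ≡-Reasoning

  shiftSum-basic-surjective : ∀ u → ∃[ ks ] shiftSum ks e ≡ u
  shiftSum-basic-surjective u = ks , vec-ext λ i → FP.toℕ-injective (begin
    toℕ (lookup (shiftSum ks e) i)
      ≡⟨ toℕ-lookup-shiftSum ks e i ⟩
    sum (List.map (λ k → toℕ (lookup (iter k H e) i)) ks) % suc c
      ≡⟨ cong (_% suc c) (sum-map-concat-replicate _ g offset) ⟩
    (∑[ j < suc b ] (g j * toℕ (lookup (iter (offset j) H e) i))) % suc c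
      ≡⟨ cong (_% suc c) (sum-cong-≗ λ j → cong (g j *_) (toℕ-lookup-shifted-basic i j)) ⟩
    (∑[ j < suc b ] (g j * indicator (toℕ i) (toℕ j))) % suc c
      ≡⟨ cong (_% suc c) (∑-indicator g i) ⟩
    g i % suc c
      ≡⟨ m<n⇒m%n≡m (FP.toℕ<n (lookup u i)) ⟩
    g i
      ∎)
    where
    open ≡-Reasoning
    g offset : Fin (suc b) → ℕ
    g j      = toℕ (lookup u j)
    offset j = b ∸ toℕ j
    ks = concat (List.tabulate λ j → List.replicate (g j) (offset j))
    vec-ext : ∀ {x y : Vec (Fin (suc c)) (suc b)} → (∀ i → lookup x i ≡ lookup y i) → x ≡ y
    vec-ext {x} {y} same = trans (sym (tabulate∘lookup x)) (trans (tabulate-cong same) (tabulate∘lookup y))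

lemma1 : ∀ (a b : ℕ) →
    HClosed (2 + a) (2 + b) ⇔ HClosedSeq (basic {2 + a} {1 + b} (s≤s (s≤s z≤n)))
lemma1 a b = mk⇔ (λ closed → closed e) basic-closed⇒closed
  where
  1<m : 1 < 2 + a
  1<m = s≤s (s≤s z≤n)
  e = basic {2 + a} {1 + b} 1<m

  basic-closed⇒closed : HClosedSeq e → HClosed (2 + a) (2 + b)
  basic-closed⇒closed closed u with ks , ks∙e≡u ← shiftSum-basic-surjective 1<m u =
    subst HClosedSeq ks∙e≡u (cycleClosedUnder-H⇒hClosedSeq
      (cycleClosedUnder-map {g = shiftSum ks} (shiftSum-commute {φ = D} D-⊕ D-𝟎 H-D-commute ks)
        (shiftSum-commute {φ = H} H-⊕ H-𝟎 (λ _ → refl) ks)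
        (eventuallyPeriodic-finite D e) e-closedUnder-H))
    where
    e-closedUnder-H : CycleClosedUnder D H e
    e-closedUnder-H y y∈ = closed y y∈ (+ 1) ℤ.-<+ (ℤ.+<+ (s≤s (s≤s z≤n)))
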